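{- Let $p,q\in V$ be two distinct variables. Then (i) $\{p,\neg p\}\not\vdash_{\mathbf{vD}}q$; (ii) $\{\circ p,p\}\not\vdash_{\mathbf{vD}}q$; (iii) $\{\circ p,\neg p\}\not\vdash_{\mathbf{vD}}q$.
   Context: Let $V$ be a denumerable set of propositional variables and $\mathcal{L}$ the set of formulas generated from $V$ by the binary connectives $\land,\lor,\longrightarrow$ and the unary connectives $\neg,\circ$. Fix a formula $\beta_0$ and set $\bot:=\beta_0\land(\neg\beta_0\land\circ\beta_0)$; for every formula $\alpha$ let $\sim\alpha$ abbreviate $\alpha\longrightarrow\bot$. The logic $\mathbf{vD}$ has axiom schemas (for all $\alpha,\beta,\gamma$, $\to$ denoting $\longrightarrow$): (1) $\alpha\to(\beta\to\alpha)$; (2) $(\alpha\to(\beta\to\gamma))\to((\alpha\to\beta)\to(\alpha\to\gamma))$; (3) $\alpha\to(\beta\to(\alpha\land\beta))$; (4) $(\alpha\land\beta)\to\alpha$; (5) $(\alpha\land\beta)\to\beta$; (6) $\alpha\to(\alpha\lor\beta)$; (7) $\beta\to(\alpha\lor\beta)$; (8) $(\alpha\to\beta)\lor\alpha$; (9) $\alpha\lor\neg\alpha$; (10) $(\alpha\to\gamma)\to((\neg\alpha\to\gamma)\to((\alpha\lor\neg\alpha)\to\gamma))$; (11) $((\alpha\to\beta)\to\gamma)\to((\alpha\to\gamma)\to(((\alpha\to\beta)\lor\alpha)\to\gamma))$; (12) $\circ\alpha\to(\alpha\to(\neg\alpha\to\beta))$; (13) $\circ\alpha\lor(\alpha\land\neg\alpha)$;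 (14) $(\circ\alpha\to\gamma)\to(((\alpha\land\neg\alpha)\to\gamma)\to((\circ\alpha\lor(\alpha\land\neg\alpha))\to\gamma))$; (15) $\sim\neg\alpha\to\sim\neg\sim\neg\alpha$; (16) $\sim\neg\sim\neg\alpha\to\sim\neg\alpha$; (17) $\sim\neg(\alpha\land\beta)\to(\sim\neg\alpha\land\sim\neg\beta)$; (18) $(\sim\neg\alpha\land\sim\neg\beta)\to\sim\neg(\alpha\land\beta)$; rules: (MP) from $\alpha$, $\alpha\longrightarrow\beta$ infer $\beta$; (N) from $\alpha$ infer $\neg\alpha\longrightarrow\sim\alpha$, applicable only when $\alpha$ is a theorem. A derivation of $\varphi$ from $\Gamma$ is a finite sequence ending in $\varphi$ each member of which is an axiom instance, a member of $\Gamma$, obtained by MP from earlier members, or obtained by (N) from an earlier member that is a theorem (derivable from $\emptyset$). $\Gamma\vdash_{\mathbf{vD}}\varphi$ iff such a derivation exists. -}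

module Defs where

open import Data.Nat using (ℕ)
open import Relation.Binary.PropositionalEquality using (_≡_)
open import Data.Sum using (_⊎_)

Var : Set
Var = ℕ

infixr 5 _⇒_
infixr 6 _∨_
infixr 7 _∧_

data Form : Set where
  var  : Var → Form
  _∧_  : Form → Form → Form
  _∨_  : Form → Form → Form
  _⇒_  : Form → Form → Form
  ¬′   : Form → Form
  ∘′   : Form → Form

module _ (β₀ : Form) where

  ⊥′ : Form
  ⊥′ = β₀ ∧ (¬′ β₀ ∧ ∘′ β₀)

  ∼ : Form → Form
  ∼ α = α ⇒ ⊥′

  data Axiom : Form → Set where
    ax1  : ∀ α β → Axiom (α ⇒ (β ⇒ α))
    ax2  : ∀ α β γ → Axiom ((α ⇒ (β ⇒ γ)) ⇒ ((α ⇒ β) ⇒ (α ⇒ γ)))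
    ax3  : ∀ α β → Axiom (α ⇒ (β ⇒ (α ∧ β)))
    ax4  : ∀ α β → Axiom ((α ∧ β) ⇒ α)
    ax5  : ∀ α β → Axiom ((α ∧ β) ⇒ β)
    ax6  : ∀ α β → Axiom (α ⇒ (α ∨ β))
    ax7  : ∀ α β → Axiom (β ⇒ (α ∨ β))
    ax8  : ∀ α β → Axiom ((α ⇒ β) ∨ α)
    ax9  : ∀ α → Axiom (α ∨ ¬′ α)
    ax10 : ∀ α γ → Axiom ((α ⇒ γ) ⇒ ((¬′ α ⇒ γ) ⇒ ((α ∨ ¬′ α) ⇒ γ)))
    ax11 : ∀ α β γ → Axiom (((α ⇒ β) ⇒ γ) ⇒ ((α ⇒ γ) ⇒ (((α ⇒ β) ∨ α) ⇒ γ)))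
    ax12 : ∀ α β → Axiom (∘′ α ⇒ (α ⇒ (¬′ α ⇒ β)))
    ax13 : ∀ α → Axiom (∘′ α ∨ (α ∧ ¬′ α))
    ax14 : ∀ α γ → Axiom ((∘′ α ⇒ γ) ⇒ (((α ∧ ¬′ α) ⇒ γ) ⇒ ((∘′ α ∨ (α ∧ ¬′ α)) ⇒ γ)))
    ax15 : ∀ α → Axiom (∼ (¬′ α) ⇒ ∼ (¬′ (∼ (¬′ α))))
    ax16 : ∀ α → Axiom (∼ (¬′ (∼ (¬′ α))) ⇒ ∼ (¬′ α))
    ax17 : ∀ α β → Axiom (∼ (¬′ (α ∧ β)) ⇒ (∼ (¬′ α) ∧ ∼ (¬′ β)))
    ax18 : ∀ α β → Axiom ((∼ (¬′ α) ∧ ∼ (¬′ β)) ⇒ ∼ (¬′ (α ∧ β)))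

  data Thm : Form → Set where
    axm : ∀ {φ} → Axiom φ → Thm φ
    mp  : ∀ {α β} → Thm α → Thm (α ⇒ β) → Thm β
    nec : ∀ {α} → Thm α → Thm (¬′ α ⇒ ∼ α)

  -- Derivability from a set of premises Γ (a predicate on formulas).
  -- Rule (N) is only applicable to theorems.
  data _⊢_ (Γ : Form → Set) : Form → Set where
    axm : ∀ {φ} → Axiom φ → Γ ⊢ φ
    hyp : ∀ {φ} → Γ φ → Γ ⊢ φ
    mp  : ∀ {α β} → Γ ⊢ α → Γ ⊢ (α ⇒ β) → Γ ⊢ β
    nec : ∀ {α} → Thm α → Γ ⊢ (¬′ α ⇒ ∼ α)

⟦_,_⟧ : Form → Form → Form → Set
⟦ a , b ⟧ φ = (φ ≡ a) ⊎ (φ ≡ b)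

{-# OPTIONS --safe #-}
-- Proof idea: vD is sound for two-valued bivaluations, which assign a truth value both to
-- every formula (val) and to its negation (val¬).  A bivaluation is fixed by the truth
-- values ρ of the variables and the set γ of "gluts": ¬x is true iff x is false or x ∈ γ.
-- On conjunctions ¬ is disjunctive (as axioms 17 and 18 demand), on every other compound
-- it is classical, and ∘α holds unless both α and ¬α do.  Every axiom is then true,
-- whatever β₀ is; modus ponens preserves truth; and rule (N) is sound because the
-- negation of a formula true under every bivaluation is false.  The three countermodels
-- make q false and, respectively, p a glut; p true with ¬p false; p false.
module Submission where

open import Defs
open import Data.Nat using (ℕ; _≟_)
open import Data.Bool using (Bool; true; false; not)
  renaming (_∧_ to _∧ᵇ_; _∨_ to _∨ᵇ_)
open import Data.Bool.Properties using (∨-zeroʳ; ∨-inverseˡ; ∨-inverseʳ)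
open import Data.Product using (_×_; _,_)
open import Data.Sum using (inj₁; inj₂)
open import Function using (_∘_; const)
open import Relation.Nullary using (¬_; contradiction; does)
open import Relation.Nullary.Decidable using (dec-true; dec-false)
open import Relation.Binary.PropositionalEquality using (_≡_; refl; sym; trans; cong; cong₂)

infixr 4 _→ᵇ_

_→ᵇ_ : Bool → Bool → Bool
true  →ᵇ y = y
false →ᵇ _ = true

→ᵇ-mp : ∀ {x y} → x ≡ true → (x →ᵇ y) ≡ true → y ≡ true
→ᵇ-mp refl x→y = x→y

→ᵇ-reflexive : ∀ {x y} → x ≡ y → (x →ᵇ y) ≡ true
→ᵇ-reflexive {false} _    = refl
→ᵇ-reflexive {true}  refl = refl

→ᵇ-const : ∀ x y → (x →ᵇ y →ᵇ x) ≡ true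
→ᵇ-const false _     = refl
→ᵇ-const true  false = refl
→ᵇ-const true  true  = refl

→ᵇ-distrib : ∀ x y z → ((x →ᵇ y →ᵇ z) →ᵇ (x →ᵇ y) →ᵇ x →ᵇ z) ≡ true
→ᵇ-distrib false _     _     = refl
→ᵇ-distrib true  false _     = refl
→ᵇ-distrib true  true  false = refl
→ᵇ-distrib true  true  true  = refl

→ᵇ-∨ᵇ-antecedent : ∀ x y → ((x →ᵇ y) ∨ᵇ x) ≡ true
→ᵇ-∨ᵇ-antecedent false _ = refl
→ᵇ-∨ᵇ-antecedent true  y = ∨-zeroʳ y

→ᵇ-explosion : ∀ x y z → (not (x ∧ᵇ y) →ᵇ x →ᵇ y →ᵇ z) ≡ true
→ᵇ-explosion false _     _ = refl
→ᵇ-explosion true  false _ = refl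
→ᵇ-explosion true  true  _ = refl

∧ᵇ-intro : ∀ x y → (x →ᵇ y →ᵇ x ∧ᵇ y) ≡ true
∧ᵇ-intro false _     = refl
∧ᵇ-intro true  false = refl
∧ᵇ-intro true  true  = refl

∧ᵇ-elimˡ : ∀ x y → (x ∧ᵇ y →ᵇ x) ≡ true
∧ᵇ-elimˡ false _     = refl
∧ᵇ-elimˡ true  false = refl
∧ᵇ-elimˡ true  true  = refl

∧ᵇ-elimʳ : ∀ x y → (x ∧ᵇ y →ᵇ y) ≡ true
∧ᵇ-elimʳ false _     = refl
∧ᵇ-elimʳ true  false = refl
∧ᵇ-elimʳ true  true  = refl

∨ᵇ-introˡ : ∀ x y → (x →ᵇ x ∨ᵇ y) ≡ true
∨ᵇ-introˡ false _ = refl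
∨ᵇ-introˡ true  _ = refl

∨ᵇ-introʳ : ∀ x y → (y →ᵇ x ∨ᵇ y) ≡ true
∨ᵇ-introʳ _ false = refl
∨ᵇ-introʳ x true  = ∨-zeroʳ x

∨ᵇ-elim : ∀ x y z → ((x →ᵇ z) →ᵇ (y →ᵇ z) →ᵇ x ∨ᵇ y →ᵇ z) ≡ true
∨ᵇ-elim false false _     = refl
∨ᵇ-elim false true  false = refl
∨ᵇ-elim false true  true  = refl
∨ᵇ-elim true  _     false = refl
∨ᵇ-elim true  false true  = refl
∨ᵇ-elim true  true  true  = refl

∨ᵇ-→ᵇ-distrib : ∀ x y z → (x ∨ᵇ y →ᵇ z) ≡ ((x →ᵇ z) ∧ᵇ (y →ᵇ z))
∨ᵇ-→ᵇ-distrib false _     _     = refl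
∨ᵇ-→ᵇ-distrib true  _     false = refl
∨ᵇ-→ᵇ-distrib true  false true  = refl
∨ᵇ-→ᵇ-distrib true  true  true  = refl

not-→ᵇ-idem : ∀ x z → (not (x →ᵇ z) →ᵇ z) ≡ (x →ᵇ z)
not-→ᵇ-idem false _     = refl
not-→ᵇ-idem true  false = refl
not-→ᵇ-idem true  true  = refl

∨ᵇ-∧ᵇ-excluded-middle : ∀ x y x¬ y¬ → x ∨ᵇ x¬ ≡ true → y ∨ᵇ y¬ ≡ true →
                        (x ∧ᵇ y) ∨ᵇ (x¬ ∨ᵇ y¬) ≡ true
∨ᵇ-∧ᵇ-excluded-middle false _     _  _ refl _    = refl
∨ᵇ-∧ᵇ-excluded-middle true  false x¬ _ _    refl = ∨-zeroʳ x¬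
∨ᵇ-∧ᵇ-excluded-middle true  true  _  _ _    _    = refl

module _ (ρ γ : Var → Bool) where

  val  : Form → Bool
  val¬ : Form → Bool

  val (var x) = ρ x
  val (α ∧ β) = val α ∧ᵇ val β
  val (α ∨ β) = val α ∨ᵇ val β
  val (α ⇒ β) = val α →ᵇ val β
  val (¬′ α)  = val¬ α
  val (∘′ α)  = not (val α ∧ᵇ val¬ α)

  val¬ (var x) = not (ρ x) ∨ᵇ γ x
  val¬ (α ∧ β) = val¬ α ∨ᵇ val¬ β
  val¬ φ       = not (val φ)

  Satisfies : (Form → Set) → Set
  Satisfies Γ = ∀ {ψ} → Γ ψ → val ψ ≡ true

  excluded-middle : ∀ φ → val φ ∨ᵇ val¬ φ ≡ true
  excluded-middle (var x) with ρ x
  ... | false = refl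
  ... | true  = refl
  excluded-middle (α ∧ β) =
    ∨ᵇ-∧ᵇ-excluded-middle (val α) (val β) (val¬ α) (val¬ β)
      (excluded-middle α) (excluded-middle β)
  excluded-middle (α ∨ β) = ∨-inverseʳ (val (α ∨ β))
  excluded-middle (α ⇒ β) = ∨-inverseʳ (val (α ⇒ β))
  excluded-middle (¬′ α)  = ∨-inverseʳ (val (¬′ α))
  excluded-middle (∘′ α)  = ∨-inverseʳ (val (∘′ α))

  axiom-true : ∀ {β₀ φ} → Axiom β₀ φ → val φ ≡ true
  axiom-true      (ax1 α β)    = →ᵇ-const (val α) (val β)
  axiom-true      (ax2 α β χ)  = →ᵇ-distrib (val α) (val β) (val χ)
  axiom-true      (ax3 α β)    = ∧ᵇ-intro (val α) (val β)
  axiom-true      (ax4 α β)    = ∧ᵇ-elimˡ (val α) (val β)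
  axiom-true      (ax5 α β)    = ∧ᵇ-elimʳ (val α) (val β)
  axiom-true      (ax6 α β)    = ∨ᵇ-introˡ (val α) (val β)
  axiom-true      (ax7 α β)    = ∨ᵇ-introʳ (val α) (val β)
  axiom-true      (ax8 α β)    = →ᵇ-∨ᵇ-antecedent (val α) (val β)
  axiom-true      (ax9 α)      = excluded-middle α
  axiom-true      (ax10 α χ)   = ∨ᵇ-elim (val α) (val¬ α) (val χ)
  axiom-true      (ax11 α β χ) = ∨ᵇ-elim (val α →ᵇ val β) (val α) (val χ)
  axiom-true      (ax12 α β)   = →ᵇ-explosion (val α) (val¬ α) (val β)
  axiom-true      (ax13 α)     = ∨-inverseˡ (val α ∧ᵇ val¬ α)
  axiom-true      (ax14 α χ)   = ∨ᵇ-elim (not (val α ∧ᵇ val¬ α)) (val α ∧ᵇ val¬ α) (val χ)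
  axiom-true {β₀} (ax15 α)     = →ᵇ-reflexive (sym (not-→ᵇ-idem (val¬ α) (val (⊥′ β₀))))
  axiom-true {β₀} (ax16 α)     = →ᵇ-reflexive (not-→ᵇ-idem (val¬ α) (val (⊥′ β₀)))
  axiom-true {β₀} (ax17 α β)   = →ᵇ-reflexive (∨ᵇ-→ᵇ-distrib (val¬ α) (val¬ β) (val (⊥′ β₀)))
  axiom-true {β₀} (ax18 α β)   = →ᵇ-reflexive (sym (∨ᵇ-→ᵇ-distrib (val¬ α) (val¬ β) (val (⊥′ β₀))))

  Satisfies-⟦,⟧ : ∀ {α β} → val α ≡ true → val β ≡ true → Satisfies ⟦ α , β ⟧
  Satisfies-⟦,⟧ α-true _      (inj₁ refl) = α-true
  Satisfies-⟦,⟧ _      β-true (inj₂ refl) = β-true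

Valid : Form → Set
Valid φ = ∀ ρ γ → val ρ γ φ ≡ true

valid⇒val¬≡false : ∀ φ → Valid φ → ∀ ρ γ → val¬ ρ γ φ ≡ false
valid⇒val¬≡false (var x) ⊨φ _ γ = contradiction (⊨φ (const false) γ) λ ()
valid⇒val¬≡false (α ∧ β) ⊨φ ρ γ =
  cong₂ _∨ᵇ_ (valid⇒val¬≡false α ⊨α ρ γ) (valid⇒val¬≡false β ⊨β ρ γ)
  where
  ⊨α : Valid α
  ⊨α ρ γ = →ᵇ-mp (⊨φ ρ γ) (∧ᵇ-elimˡ (val ρ γ α) (val ρ γ β))
  ⊨β : Valid β
  ⊨β ρ γ = →ᵇ-mp (⊨φ ρ γ) (∧ᵇ-elimʳ (val ρ γ α) (val ρ γ β))
valid⇒val¬≡false (α ∨ β) ⊨φ ρ γ = cong not (⊨φ ρ γ)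
valid⇒val¬≡false (α ⇒ β) ⊨φ ρ γ = cong not (⊨φ ρ γ)
valid⇒val¬≡false (¬′ α)  ⊨φ ρ γ = cong not (⊨φ ρ γ)
valid⇒val¬≡false (∘′ α)  ⊨φ ρ γ = cong not (⊨φ ρ γ)

nec-valid : ∀ β₀ α → Valid α → Valid (¬′ α ⇒ ∼ β₀ α)
nec-valid β₀ α ⊨α ρ γ = cong (_→ᵇ val ρ γ (∼ β₀ α)) (valid⇒val¬≡false α ⊨α ρ γ)

Thm-valid : ∀ {β₀ φ} → Thm β₀ φ → Valid φ
Thm-valid      (axm ax)      ρ γ = axiom-true ρ γ ax
Thm-valid      (mp ⊢α ⊢α⇒β) ρ γ = →ᵇ-mp (Thm-valid ⊢α ρ γ) (Thm-valid ⊢α⇒β ρ γ)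
Thm-valid {β₀} (nec {α} ⊢α)  ρ γ = nec-valid β₀ α (Thm-valid ⊢α) ρ γ

⊢-sound : ∀ {β₀ Γ φ} ρ γ → Satisfies ρ γ Γ → _⊢_ β₀ Γ φ → val ρ γ φ ≡ true
⊢-sound      ρ γ _  (axm ax)      = axiom-true ρ γ ax
⊢-sound      ρ γ ⊨Γ (hyp φ∈Γ)     = ⊨Γ φ∈Γ
⊢-sound      ρ γ ⊨Γ (mp ⊢α ⊢α⇒β) = →ᵇ-mp (⊢-sound ρ γ ⊨Γ ⊢α) (⊢-sound ρ γ ⊨Γ ⊢α⇒β)
⊢-sound {β₀} ρ γ _  (nec {α} ⊢α)  = nec-valid β₀ α (Thm-valid ⊢α) ρ γ

countermodel⇒⊬ : ∀ {β₀ Γ φ} ρ γ → Satisfies ρ γ Γ → val ρ γ φ ≡ false → ¬ (_⊢_ β₀ Γ φ)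
countermodel⇒⊬ ρ γ ⊨Γ φ-false ⊢φ =
  contradiction (trans (sym φ-false) (⊢-sound ρ γ ⊨Γ ⊢φ)) λ ()

theorem5p2 : (β₀ : Form) (p q : ℕ) → ¬ (p ≡ q) →
      (¬ (_⊢_ β₀ ⟦ var p , ¬′ (var p) ⟧ (var q)))
    × (¬ (_⊢_ β₀ ⟦ ∘′ (var p) , var p ⟧ (var q)))
    × (¬ (_⊢_ β₀ ⟦ ∘′ (var p) , ¬′ (var p) ⟧ (var q)))
theorem5p2 β₀ p q p≢q =
    countermodel⇒⊬ only-p (const true)
      (Satisfies-⟦,⟧ only-p _ p-true (∨-zeroʳ (not (only-p p)))) q-false
  , countermodel⇒⊬ only-p (const false)
      (Satisfies-⟦,⟧ only-p _ ∘p-true p-true) q-false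
  , countermodel⇒⊬ (const false) (const false)
      (Satisfies-⟦,⟧ (const false) _ refl refl) refl
  where
  only-p : Var → Bool
  only-p x = does (x ≟ p)

  p-true : only-p p ≡ true
  p-true = dec-true (p ≟ p) refl

  q-false : only-p q ≡ false
  q-false = dec-false (q ≟ p) (p≢q ∘ sym)

  ∘p-true : val only-p (const false) (∘′ (var p)) ≡ true
  ∘p-true = cong (λ b → not (b ∧ᵇ (not b ∨ᵇ false))) p-true
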